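{- Let $G$ be a graph and let $S\subseteq V(G)$ be an independent set with $|S|=s$. Suppose there are connected components $C_1,\dots,C_l$ of $G-S$ such that each $C_i$ has a neighbor of every vertex of $S$, and for any two vertices $u,v\in S$ there is a path of even length between $u$ and $v$ in the subgraph of $G$ induced by $V(C_i)\cup\{u,v\}$. If $l\ge s$, then $S$ can be contracted into a single vertex via odd-minor-operations using (only) the components $C_1,\dots,C_l$.
   Context: An odd-minor-operation on a graph consists of first deleting some vertices and edges, then choosing an edge cut $R$ (the set of all edges between some vertex set and its complement) and contracting all edges of $R$. -}

module Defs where

open import Data.Nat using (ℕ; zero; suc; _+_; _%_)
open import Data.Bool using (Bool)
open import Data.Fin using (Fin)
open import Data.Fin.Subset using (Subset; _∈_; _∉_; ∣_∣)
open import Data.List using (List; []; _∷_)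
open import Data.List.Relation.Unary.Unique.Propositional using (Unique)
open import Data.Product using (Σ; ∃; _×_; _,_)
open import Data.Sum using (_⊎_)
open import Relation.Nullary using (¬_)
open import Relation.Binary.PropositionalEquality using (_≡_; _≢_)

record Graph (n : ℕ) : Set₁ where
  field
    E      : Fin n → Fin n → Set
    E-sym  : ∀ {u v} → E u v → E v u
    E-irr  : ∀ {u} → ¬ E u u
open Graph public

module _ {n : ℕ} where

  data Walk (R : Fin n → Fin n → Set) (P : Fin n → Set) : Fin n → Fin n → Set where
    here : ∀ {u} → P u → Walk R P u u
    step : ∀ {u w v} → P u → R u w → Walk R P w v → Walk R P u v

  walkVertices : ∀ {R P u v} → Walk R P u v → List (Fin n)
  walkVertices (here {u} _)       = u ∷ []
  walkVertices (step {u} _ _ w)   = u ∷ walkVertices w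

  walkLength : ∀ {R P u v} → Walk R P u v → ℕ
  walkLength (here _)     = zero
  walkLength (step _ _ w) = suc (walkLength w)

  EvenPath : Graph n → (Fin n → Set) → Fin n → Fin n → Set
  EvenPath G P u v =
    Σ (Walk (E G) P u v) λ w → Unique (walkVertices w) × (walkLength w % 2 ≡ 0)

  Independent : Graph n → Subset n → Set
  Independent G S = ∀ {x y} → x ∈ S → y ∈ S → ¬ E G x y

  IsComponentOf- : Graph n → Subset n → Subset n → Set
  IsComponentOf- G S C =
      (∃ λ x → x ∈ C)
    × (∀ {x} → x ∈ C → x ∉ S)
    × (∀ {x y} → x ∈ C → y ∈ C → Walk (E G) (λ z → z ∉ S) x y)
    × (∀ {x y} → x ∈ C → y ∉ S → E G x y → y ∈ C)

  -- One odd-minor-operation on G: delete the vertices delV and the edges delE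
  -- (an edge uv is deleted if delE u v or delE v u), then contract the edge cut
  -- determined by the bipartition given by `side`.
  record OddMinorOp (G : Graph n) : Set₁ where
    field
      delV : Subset n
      delE : Fin n → Fin n → Set
      side : Fin n → Bool

    HE : Fin n → Fin n → Set
    HE u v = E G u v × u ∉ delV × v ∉ delV × ¬ delE u v × ¬ delE v u

    Cut : Fin n → Fin n → Set
    Cut u v = HE u v × side u ≢ side v

    Merged : Fin n → Fin n → Set
    Merged u v = Walk Cut (λ z → z ∉ delV) u v
  open OddMinorOp public

  ContractsInto1Using : (G : Graph n) → Subset n → (Fin n → Set) → Set₁
  ContractsInto1Using G S U = Σ (OddMinorOp G) λ op →
      (∀ {x} → x ∈ S → x ∉ delV op)
    × (∀ {x y} → x ∈ S → y ∈ S → Merged op x y)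
    × (∀ {x} → x ∈ delV op → U x)
    × (∀ {u v} → E G u v → delE op u v → U u × U v)
    × (∀ {u v} → Cut op u v → U u × U v)

module Submission where

-- Fix x₀ ∈ S.  As |S| ≤ l, label the elements of S injectively by
-- component indices and, for x ∈ S, take the even path π_x from x₀ to x through
-- its own component.  Colour a vertex false iff it sits at an odd position of
-- some π_x.  Colours alternate along every π_x: an even-position vertex z of
-- π_x cannot be odd on some π_{x'}, because odd positions are interior, so z
-- would lie in the components of both x and x', forcing x = x' and a repeated
-- vertex on π_x.  So each π_x uses only edges of the cut between the colour
-- classes, and contracting that cut (deleting nothing) merges S into x₀.  A cut
-- edge has a false end in some C i, so its other end is in C i or in S.

open import Defs
open import Data.Nat using (ℕ; zero; suc; _≤_; _<_; s≤s; z≤n; _%_)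
open import Data.Nat.Properties using (≤-trans; suc-injective)
open import Data.Fin using (Fin; zero; suc; fromℕ<)
open import Data.Fin.Properties using (any?; fromℕ<-injective) renaming (_≟_ to _≟F_)
open import Data.Fin.Subset using (Subset; _∈_; _∉_; ∣_∣; ⊥)
open import Data.Fin.Subset.Properties using (∉⊥; ⊆-antisym; _∈?_; nonempty?)
open import Data.Vec using (_∷_; here; there)
open import Data.Bool using (Bool; true; false; not)
open import Data.Bool.Properties using (not-involutive; ¬-not)
open import Data.List using (List; []; _∷_)
open import Data.List.Relation.Unary.Any using (Any; here; there)
open import Data.List.Relation.Unary.All using () renaming (lookup to All-lookup)
open import Data.List.Relation.Unary.AllPairs using ([]; _∷_)
open import Data.List.Relation.Unary.Unique.Propositional using (Unique)
open import Data.Product using (∃; Σ; _×_; _,_; proj₁; proj₂; swap)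
open import Data.Sum using (_⊎_; inj₁; inj₂)
open import Data.Empty using () renaming (⊥ to Empty)
open import Function using (_∘_; id)
open import Relation.Nullary using (¬_; Dec; yes; no; does; contradiction)
open import Relation.Binary using (Symmetric; DecidableEquality)
open import Relation.Binary.PropositionalEquality
  using (_≡_; _≢_; refl; sym; trans; cong; subst)

module _ {A : Set} where

  -- Occ b L z : z occurs in L at an even (b = true) or odd (b = false)
  -- position, counting from 0.
  data Occ : Bool → List A → A → Set where
    hd : ∀ {z r} → Occ true (z ∷ r) z
    tl : ∀ {b a r z} → Occ (not b) r z → Occ b (a ∷ r) z

  tl-flip : ∀ {c a r z} → Occ c r z → Occ (not c) (a ∷ r) z
  tl-flip {c} o = tl (subst (λ b → Occ b _ _) (sym (not-involutive c)) o)

  occ? : DecidableEquality A → ∀ b L z → Dec (Occ b L z)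
  occ? _≟_ b [] z = no λ ()
  occ? _≟_ true (a ∷ r) z with a ≟ z | occ? _≟_ false r z
  ... | yes refl | _     = yes hd
  ... | no _     | yes o = yes (tl o)
  ... | no a≢z   | no ¬o = no λ { hd → a≢z refl ; (tl o) → ¬o o }
  occ? _≟_ false (a ∷ r) z with occ? _≟_ true r z
  ... | yes o = yes (tl o)
  ... | no ¬o = no λ { (tl o) → ¬o o }

  occ⇒any : ∀ {c L z} → Occ c L z → Any (z ≡_) L
  occ⇒any hd     = here refl
  occ⇒any (tl o) = there (occ⇒any o)

  unique-parity : ∀ {b L z} → Unique L → Occ b L z → Occ (not b) L z → Empty
  unique-parity {true}  (a∉r ∷ _) hd     (tl o) = All-lookup a∉r (occ⇒any o) refl
  unique-parity {false} (a∉r ∷ _) (tl o) hd     = All-lookup a∉r (occ⇒any o) refl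
  unique-parity {true}  (_ ∷ u)   (tl o) (tl o′) = unique-parity u o o′
  unique-parity {false} (_ ∷ u)   (tl o) (tl o′) = unique-parity u o o′

parity : ℕ → Bool
parity zero    = true
parity (suc k) = not (parity k)

parity-even : ∀ k → k % 2 ≡ 0 → parity k ≡ true
parity-even zero          _ = refl
parity-even (suc zero)    ()
parity-even (suc (suc k)) e = trans (not-involutive (parity k)) (parity-even k e)

module _ {n : ℕ} {R : Fin n → Fin n → Set} {P : Fin n → Set} where

  walk-head : ∀ {a b} → Walk R P a b → P a
  walk-head (here p)     = p
  walk-head (step p _ _) = p

  occ-vertex : ∀ {a b c z} (w : Walk R P a b) → Occ c (walkVertices w) z → P z
  occ-vertex (here p)     hd      = p
  occ-vertex (here p)     (tl ())
  occ-vertex (step p _ _) hd      = p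
  occ-vertex (step _ _ w) (tl o)  = occ-vertex w o

  first-even : ∀ {a b} (w : Walk R P a b) → Occ true (walkVertices w) a
  first-even (here _)     = hd
  first-even (step _ _ _) = hd

  last-parity : ∀ {a b} (w : Walk R P a b)
    → Occ (parity (walkLength w)) (walkVertices w) b
  last-parity (here _)     = hd
  last-parity (step _ _ w) = tl-flip (last-parity w)

  last-even : ∀ {a b} (w : Walk R P a b) → walkLength w % 2 ≡ 0
    → Occ true (walkVertices w) b
  last-even {b = b} w ev =
    subst (λ c → Occ c (walkVertices w) b) (parity-even (walkLength w) ev) (last-parity w)

  join : Symmetric R → ∀ {a b c} → Walk R P a b → Walk R P a c → Walk R P b c
  join R-sym (here _)     acc = acc
  join R-sym (step _ r w) acc = join R-sym w (step (walk-head w) (R-sym r) acc)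

  odd-interior : ∀ {u v z} (w : Walk R P u v) → Unique (walkVertices w)
    → walkLength w % 2 ≡ 0 → Occ false (walkVertices w) z → z ≢ u × z ≢ v
  odd-interior w uniq ev o =
      (λ { refl → unique-parity uniq (first-even w) o })
    , (λ { refl → unique-parity uniq (last-even w ev) o })

one-false : ∀ {a b} → a ≢ b → a ≡ false ⊎ b ≡ false
one-false {false}         _ = inj₁ refl
one-false {true}  {false} _ = inj₂ refl
one-false {true}  {true}  d = contradiction refl d

mapWalk : ∀ {n} {R R′ : Fin n → Fin n → Set} {P P′ : Fin n → Set}
  → (∀ {u v} → R u v → R′ u v) → (∀ {u} → P u → P′ u)
  → ∀ {a b} → Walk R P a b → Walk R′ P′ a b
mapWalk f g (here p)     = here (g p)
mapWalk f g (step p r w) = step (g p) (f r) (mapWalk f g w)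

module _ {n : ℕ} where

  Bichromatic : (Fin n → Bool) → (Fin n → Fin n → Set) → Fin n → Fin n → Set
  Bichromatic f R u v = R u v × f u ≢ f v

  bichromatic-sym : ∀ {f R} → Symmetric R → Symmetric (Bichromatic f R)
  bichromatic-sym R-sym (r , d) = R-sym r , d ∘ sym

  ParityColouring : (Fin n → Bool) → List (Fin n) → Set
  ParityColouring f L = ∀ {c z} → Occ c L z → f z ≡ c

  -- A walk coloured by parity of position alternates colours at every step,
  -- hence is a walk of bichromatic edges.  The tail is coloured by `not ∘ f`.
  alternating-walk : ∀ {R P} (f : Fin n → Bool) {a b} (w : Walk R P a b)
    → ParityColouring f (walkVertices w) → Walk (Bichromatic f R) P a b
  alternating-walk f (here p) _ = here p
  alternating-walk {R} f (step p r w) col =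
    step p (r , ends-differ) (mapWalk uncomplement id (alternating-walk (not ∘ f) w col-tail))
    where
    ends-differ : f _ ≢ f _
    ends-differ eq with trans (sym (col hd)) (trans eq (col (tl (first-even w))))
    ... | ()
    col-tail : ParityColouring (not ∘ f) (walkVertices w)
    col-tail o = trans (cong not (col (tl-flip o))) (not-involutive _)
    uncomplement : ∀ {u v} → Bichromatic (not ∘ f) R u v → Bichromatic f R u v
    uncomplement (r , d) = r , d ∘ cong not

rank : ∀ {m} → Subset m → Fin m → ℕ
rank (_ ∷ p)     zero    = 0
rank (true ∷ p)  (suc x) = suc (rank p x)
rank (false ∷ p) (suc x) = rank p x

rank< : ∀ {m} {p : Subset m} {x} → x ∈ p → rank p x < ∣ p ∣
rank< here = s≤s z≤n
rank< {p = true ∷ p}  (there x∈p) = s≤s (rank< x∈p)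
rank< {p = false ∷ p} (there x∈p) = rank< x∈p

rank-injective : ∀ {m} {p : Subset m} {x y} → x ∈ p → y ∈ p → rank p x ≡ rank p y → x ≡ y
rank-injective here here _ = refl
rank-injective {p = true ∷ p}  here        (there _)   ()
rank-injective {p = true ∷ p}  (there _)   here        ()
rank-injective {p = true ∷ p}  (there x∈p) (there y∈p) e =
  cong suc (rank-injective x∈p y∈p (suc-injective e))
rank-injective {p = false ∷ p} (there x∈p) (there y∈p) e =
  cong suc (rank-injective x∈p y∈p e)

label : ∀ {m l} {p : Subset m} → ∣ p ∣ ≤ l → ∀ {x} → x ∈ p → Fin l
label le x∈p = fromℕ< (≤-trans (rank< x∈p) le)

label-injective : ∀ {m l} {p : Subset m} (le : ∣ p ∣ ≤ l) {x y} (x∈p : x ∈ p) (y∈p : y ∈ p)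
  → label le x∈p ≡ label le y∈p → x ≡ y
label-injective le x∈p y∈p eq = rank-injective x∈p y∈p (fromℕ<-injective _ _ _ _ eq)

module _ {n : ℕ} {G : Graph n} {S : Subset n} where

  component-closed : ∀ {A a b} → IsComponentOf- G S A → a ∈ A
    → Walk (E G) (_∉ S) a b → b ∈ A
  component-closed A-comp a∈A (here _) = a∈A
  component-closed A-comp@(_ , _ , _ , closed) a∈A (step _ e w) =
    component-closed A-comp (closed a∈A (walk-head w) e) w

  components-overlap : ∀ {A B z} → IsComponentOf- G S A → IsComponentOf- G S B
    → z ∈ A → z ∈ B → A ≡ B
  components-overlap A-comp B-comp z∈A z∈B =
    ⊆-antisym (included A-comp B-comp z∈A z∈B) (included B-comp A-comp z∈B z∈A)
    where
    included : ∀ {A B z} → IsComponentOf- G S A → IsComponentOf- G S B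
      → z ∈ A → z ∈ B → ∀ {y} → y ∈ A → y ∈ B
    included (_ , _ , connected , _) B-comp z∈A z∈B y∈A =
      component-closed B-comp z∈B (connected z∈A y∈A)

  contractCut : (Fin n → Bool) → OddMinorOp G
  contractCut f = record { delV = ⊥ ; delE = λ _ _ → Empty ; side = f }

  contract-cut : ∀ {P : Fin n → Set} {U : Fin n → Set} (f : Fin n → Bool)
    → (∀ {x y} → x ∈ S → y ∈ S → Walk (Bichromatic f (E G)) P x y)
    → (∀ {u v} → Bichromatic f (E G) u v → U u × U v)
    → ContractsInto1Using G S U
  contract-cut f merge within =
      contractCut f
    , (λ _ → ∉⊥)
    , (λ x∈S y∈S → mapWalk as-cut (λ _ → ∉⊥) (merge x∈S y∈S))
    , (λ x∈⊥ → contradiction x∈⊥ ∉⊥)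
    , (λ _ ())
    , (λ { ((e , _) , d) → within (e , d) })
    where
    as-cut : ∀ {u v} → Bichromatic f (E G) u v → Cut (contractCut f) u v
    as-cut (e , d) = (e , ∉⊥ , ∉⊥ , (λ ()) , (λ ())) , d

module Construction {n : ℕ} (G : Graph n) (S : Subset n) (l : ℕ) (C : Fin l → Subset n)
    (comp : ∀ i → IsComponentOf- G S (C i))
    (injC : ∀ i j → C i ≡ C j → i ≡ j)
    (evp : ∀ i {u v} → u ∈ S → v ∈ S
        → EvenPath G (λ z → z ∈ C i ⊎ z ≡ u ⊎ z ≡ v) u v)
    (le : ∣ S ∣ ≤ l) {x₀ : Fin n} (x₀∈S : x₀ ∈ S) where

  Touched : Fin n → Set
  Touched z = z ∈ S ⊎ ∃ λ i → z ∈ C i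

  outside-S : ∀ {i z} → z ∈ C i → z ∉ S
  outside-S {i} = proj₁ (proj₂ (comp i))

  neighbour-in : ∀ {i z y} → z ∈ C i → y ∉ S → E G z y → y ∈ C i
  neighbour-in {i} = proj₂ (proj₂ (proj₂ (comp i)))

  component-unique : ∀ {i j z} → z ∈ C i → z ∈ C j → i ≡ j
  component-unique z∈Ci z∈Cj =
    injC _ _ (components-overlap {G = G} (comp _) (comp _) z∈Ci z∈Cj)

  OnPath : ∀ {x} → x ∈ S → Fin n → Set
  OnPath {x} x∈S z = z ∈ C (label le x∈S) ⊎ z ≡ x₀ ⊎ z ≡ x

  onPath-touched : ∀ {x z} (x∈S : x ∈ S) → OnPath x∈S z → Touched z
  onPath-touched x∈S (inj₁ z∈C)         = inj₂ (_ , z∈C)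
  onPath-touched x∈S (inj₂ (inj₁ refl)) = inj₁ x₀∈S
  onPath-touched x∈S (inj₂ (inj₂ refl)) = inj₁ x∈S

  path : ∀ {x} (x∈S : x ∈ S) → EvenPath G (OnPath x∈S) x₀ x
  path x∈S = evp (label le x∈S) x₀∈S x∈S

  pathWalk : ∀ {x} (x∈S : x ∈ S) → Walk (E G) (OnPath x∈S) x₀ x
  pathWalk x∈S = proj₁ (path x∈S)

  path-vertex : ∀ {x c z} (x∈S : x ∈ S) → Occ c (walkVertices (pathWalk x∈S)) z
    → z ∈ C (label le x∈S) ⊎ z ∈ S
  path-vertex x∈S o with occ-vertex (pathWalk x∈S) o
  ... | inj₁ z∈C         = inj₁ z∈C
  ... | inj₂ (inj₁ refl) = inj₂ x₀∈S
  ... | inj₂ (inj₂ refl) = inj₂ x∈S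

  path-odd : ∀ {x z} (x∈S : x ∈ S) → Occ false (walkVertices (pathWalk x∈S)) z
    → z ∈ C (label le x∈S)
  path-odd x∈S o with path x∈S
  ... | w , uniq , ev with occ-vertex w o | odd-interior w uniq ev o
  ...   | inj₁ z∈C         | _         = z∈C
  ...   | inj₂ (inj₁ z≡x₀) | z≢x₀ , _  = contradiction z≡x₀ z≢x₀
  ...   | inj₂ (inj₂ z≡x)  | _ , z≢x   = contradiction z≡x z≢x

  -- The vertex sequence of the path to x, made total (empty when x ∉ S) so
  -- that it can be quantified over all vertices.
  route : Fin n → List (Fin n)
  route x with x ∈? S
  ... | yes x∈S = walkVertices (pathWalk x∈S)
  ... | no _    = []

  route-unique : ∀ x → Unique (route x)
  route-unique x with x ∈? S
  ... | yes x∈S = proj₁ (proj₂ (path x∈S))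
  ... | no _    = []

  route-path : ∀ {x} → x ∈ S → Σ (x ∈ S) λ x∈S → route x ≡ walkVertices (pathWalk x∈S)
  route-path {x} x∈S with x ∈? S
  ... | yes x∈S′ = x∈S′ , refl
  ... | no x∉S   = contradiction x∈S x∉S

  route-occ : ∀ x {c z} → Occ c (route x) z
    → Σ (x ∈ S) λ x∈S → Occ c (walkVertices (pathWalk x∈S)) z
  route-occ x o with x ∈? S
  ... | yes x∈S = x∈S , o
  route-occ x () | no _

  OddOnSomeRoute : Fin n → Set
  OddOnSomeRoute z = ∃ λ x → Occ false (route x) z

  colour : Fin n → Bool
  colour z = not (does (any? (λ x → occ? _≟F_ false (route x) z)))

  colour-false : ∀ {z} → OddOnSomeRoute z → colour z ≡ false
  colour-false {z} odd with any? (λ x → occ? _≟F_ false (route x) z)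
  ... | yes _    = refl
  ... | no ¬odd  = contradiction odd ¬odd

  colour-false⁻¹ : ∀ {z} → colour z ≡ false → OddOnSomeRoute z
  colour-false⁻¹ {z} eq with any? (λ x → occ? _≟F_ false (route x) z)
  ... | yes odd = odd
  colour-false⁻¹ () | no _

  -- A vertex at an even position of route x is not odd on any route x′:
  -- it would lie in the components of both x and x′, so x = x′, contradicting
  -- that route x has no repetitions.
  even-not-odd : ∀ x {z} → Occ true (route x) z → ¬ OddOnSomeRoute z
  even-not-odd x o (x′ , o′) with route-occ x o | route-occ x′ o′
  ... | x∈S , o₁ | x′∈S , o₁′ with path-vertex x∈S o₁ | path-odd x′∈S o₁′
  ...   | inj₂ z∈S | z∈C′ = outside-S z∈C′ z∈S
  ...   | inj₁ z∈C | z∈C′ =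
    unique-parity (route-unique x) o (subst (λ y → Occ false (route y) _) (sym x≡x′) o′)
    where
    x≡x′ : x ≡ x′
    x≡x′ = label-injective le x∈S x′∈S (component-unique z∈C z∈C′)

  route-coloured : ∀ x → ParityColouring colour (route x)
  route-coloured x {false} o = colour-false (x , o)
  route-coloured x {true}  o = ¬-not (even-not-odd x o ∘ colour-false⁻¹)

  to-base : ∀ {x} → x ∈ S → Walk (Bichromatic colour (E G)) Touched x₀ x
  to-base {x} x∈S with route-path x∈S
  ... | x∈S′ , eq = mapWalk id (onPath-touched x∈S′)
                      (alternating-walk colour (pathWalk x∈S′)
                        (subst (ParityColouring colour) eq (route-coloured x)))

  -- A false vertex lies in some C i; each of its neighbours is in S or in C i.
  false-within : ∀ {u v} → colour u ≡ false → E G u v → Touched u × Touched v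
  false-within {v = v} eq e with colour-false⁻¹ eq
  ... | x , o with route-occ x o
  ...   | x∈S , o₁ with path-odd x∈S o₁ | v ∈? S
  ...     | u∈C | yes v∈S = inj₂ (_ , u∈C) , inj₁ v∈S
  ...     | u∈C | no v∉S  = inj₂ (_ , u∈C) , inj₂ (_ , neighbour-in u∈C v∉S e)

  -- Every cut edge has a false end, so lies within Touched.
  bichromatic-within : ∀ {u v} → Bichromatic colour (E G) u v → Touched u × Touched v
  bichromatic-within (e , d) with one-false d
  ... | inj₁ cu = false-within cu e
  ... | inj₂ cv = swap (false-within cv (E-sym G e))

  contracts : ContractsInto1Using G S Touched
  contracts = contract-cut colour
    (λ x∈S y∈S → join (bichromatic-sym {f = colour} {R = E G} (E-sym G))
                      (to-base x∈S) (to-base y∈S))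
    bichromatic-within

lemma7p8 : ∀ {n : ℕ} (G : Graph n) (S : Subset n) (l : ℕ) (C : Fin l → Subset n)
    → Independent G S
    → (∀ i → IsComponentOf- G S (C i))
    → (∀ i j → C i ≡ C j → i ≡ j)
    → (∀ i {x} → x ∈ S → ∃ λ y → y ∈ C i × E G x y)
    → (∀ i {u v} → u ∈ S → v ∈ S
        → EvenPath G (λ z → z ∈ C i ⊎ z ≡ u ⊎ z ≡ v) u v)
    → ∣ S ∣ ≤ l
    → ContractsInto1Using G S (λ z → z ∈ S ⊎ ∃ λ i → z ∈ C i)
lemma7p8 G S l C _ comp injC _ evp le with nonempty? S
... | yes (_ , x₀∈S) = Construction.contracts G S l C comp injC evp le x₀∈S
... | no S-empty     = contract-cut {G = G} {P = λ _ → Empty} (λ _ → true)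
                         (λ x∈S _ → contradiction (_ , x∈S) S-empty)
                         (λ { (_ , d) → contradiction refl d })
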